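{- For $n\ge0$ let $a_n$ be the number of permutations $\pi$ of $\{1,\dots,n\}$ with $\#132(\pi)=0$ and $\#123(\pi)=3$. Then $$\sum_{n\ge0}a_nz^n=\frac{z^5(z-1)^2}{(1-2z)^4}.$$
   Context: For a permutation $\pi=\pi_1\cdots\pi_n$, $\#123(\pi)$ is the number of triples $i_1<i_2<i_3$ with $\pi_{i_1}<\pi_{i_2}<\pi_{i_3}$, and $\#132(\pi)$ is the number of triples $i_1<i_2<i_3$ with $\pi_{i_1}<\pi_{i_3}<\pi_{i_2}$. -}

module Defs where

open import Data.Nat using (ℕ; zero; suc; _∸_; _<ᵇ_; _≡ᵇ_)
open import Data.Bool using (Bool; true; false; _∧_; if_then_else_; not)
open import Data.Fin using (Fin; toℕ)
open import Data.List using (List; []; _∷_; [_]; map; concatMap; length; filterᵇ; allFin; foldr)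
open import Data.Vec using (Vec; lookup) renaming ([] to []ᵥ; _∷_ to _∷ᵥ_)
open import Data.Integer using (ℤ; +_; -[1+_]) renaming (_+_ to _+ℤ_; _*_ to _*ℤ_)
open import Data.List using (upTo)

words : {A : Set} → List A → (k : ℕ) → List (Vec A k)
words xs zero    = [ []ᵥ ]
words xs (suc k) = concatMap (λ x → map (x ∷ᵥ_) (words xs k)) xs

sumL : {A : Set} → List A → (A → ℕ) → ℕ
sumL xs f = foldr (λ x acc → f x Data.Nat.+ acc) 0 xs

isPerm : {n : ℕ} → Vec (Fin n) n → Bool
isPerm {n} v = sumL (allFin n) (λ i → sumL (allFin n) (λ j →
  if (toℕ i <ᵇ toℕ j) ∧ (toℕ (lookup v i) ≡ᵇ toℕ (lookup v j)) then 1 else 0)) ≡ᵇ 0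

countTriples : {n : ℕ} → (ℕ → ℕ → ℕ → Bool) → Vec (Fin n) n → ℕ
countTriples {n} P v = sumL (allFin n) (λ i → sumL (allFin n) (λ j → sumL (allFin n) (λ k →
  if (toℕ i <ᵇ toℕ j) ∧ (toℕ j <ᵇ toℕ k)
       ∧ P (toℕ (lookup v i)) (toℕ (lookup v j)) (toℕ (lookup v k))
  then 1 else 0)))

occ123 : {n : ℕ} → Vec (Fin n) n → ℕ
occ123 = countTriples (λ a b c → (a <ᵇ b) ∧ (b <ᵇ c))

occ132 : {n : ℕ} → Vec (Fin n) n → ℕ
occ132 = countTriples (λ a b c → (a <ᵇ c) ∧ (c <ᵇ b))

-- permutations of {1,…,n} (values shifted to {0,…,n-1}, i.e. Fin n)
perms : (n : ℕ) → List (Vec (Fin n) n)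
perms n = filterᵇ isPerm (words (allFin n) n)

a : ℕ → ℕ
a n = length (filterᵇ (λ π → (occ132 π ≡ᵇ 0) ∧ (occ123 π ≡ᵇ 3)) (perms n))

Series : Set
Series = ℕ → ℤ

sumZ : List ℕ → (ℕ → ℤ) → ℤ
sumZ xs f = foldr (λ x acc → f x +ℤ acc) (+ 0) xs

_⋆_ : Series → Series → Series
(f ⋆ g) n = sumZ (upTo (suc n)) (λ k → f k *ℤ g (n ∸ k))

-- series of a polynomial given by its coefficient list (constant term first)
poly : List ℤ → Series
poly []       n       = + 0
poly (c ∷ cs) zero    = c
poly (c ∷ cs) (suc n) = poly cs n

ogf : (ℕ → ℕ) → Series
ogf f n = + (f n)

z : Series
z = poly (+ 0 ∷ + 1 ∷ [])

one : Series
one = poly (+ 1 ∷ [])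

oneMinus2z : Series
oneMinus2z = poly (+ 1 ∷ -[1+ 1 ] ∷ [])

zMinus1 : Series
zMinus1 = poly (-[1+ 0 ] ∷ + 1 ∷ [])

_^ₛ_ : Series → ℕ → Series
f ^ₛ zero  = one
f ^ₛ suc k = f ⋆ (f ^ₛ k)

{-# OPTIONS --safe #-}
module Submission where

-- Let π avoid 132 and have first entry x, with h entries larger than x. Avoiding 132 forces
-- the entries above x to occur in increasing order after it, so x starts exactly C(h,2)
-- copies of 123, and deleting x leaves a 132-avoider whose entries above x increase. Hence
-- the number of 132-avoiders of length n with r copies of 123 whose g largest entries
-- increase satisfies a recursion over h (avoiders). As C(h,2) ≤ r ≤ 3 forces h ≤ 3, for
-- n ≥ 4 this is a linear system among the 16 sequences with g, r ≤ 3; hence the recurrence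
-- of (1 − 2z)⁴, checked at index 5 by computation, propagates to all later indices. So the
-- product of ∑ aₙ zⁿ with (1 − 2z)⁴ has no terms beyond z⁸, and the first nine are computed.

open import Defs
open import Data.Bool using (Bool; true; false; T; _∧_; if_then_else_)
open import Data.Bool.Properties
  using (∧-zeroʳ; ∧-identityʳ; ∧-assoc; T-≡; T-∧; ∧-commutativeMonoid)
open import Data.Empty using (⊥-elim)
open import Data.Fin as Fin using (Fin; toℕ; fromℕ<) renaming (zero to 0F; suc to 1+)
open import Data.Fin.Permutation using (reverse)
open import Data.Fin.Properties using (toℕ<n; toℕ-fromℕ<; opposite-prop; toℕ-inject₁; toℕ-fromℕ)
open import Data.List
  using (List; []; _∷_; _++_; map; length; tabulate; allFin; concatMap; filterᵇ; applyUpTo)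
open import Data.List.Relation.Unary.All using (All; []; _∷_)
open import Data.Nat
open import Data.Nat.Combinatorics using (_C_; nC1≡n; nCk+nC[k+1]≡[n+1]C[k+1])
open import Data.Nat.Properties
open import Data.Nat.Tactic.RingSolver using (solve-∀)
open import Data.Product using (_×_; _,_)
open import Data.Vec using (Vec; lookup) renaming (_∷_ to _∷ᵥ_)
open import Function using (_∘_; id)
open import Function.Bundles using (Equivalence)
open import Relation.Binary.Definitions using (tri<; tri≈; tri>)
open import Relation.Binary.PropositionalEquality
open import Relation.Nullary using (¬_; yes; no)

open import Algebra.Properties.CommutativeMonoid.Sum +-0-commutativeMonoid
  using (sum; sum-syntax; sum-cong-≗; sum-replicate-zero; sum-remove; sum-permute)
open import Algebra.Properties.CommutativeSemigroup +-commutativeSemigroup using (interchange)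
open import Algebra.Solver.CommutativeMonoid ∧-commutativeMonoid using (solve; _⊕_; _⊜_)

private variable
  A B : Set

𝟙 : Bool → ℕ
𝟙 b = if b then 1 else 0

𝟙-mono : ∀ {b c} → (T b → T c) → 𝟙 b ≤ 𝟙 c
𝟙-mono {false}         _ = z≤n
𝟙-mono {true}  {true}  _ = ≤-refl
𝟙-mono {true}  {false} f = ⊥-elim (f _)

if-𝟙 : ∀ b c → (if b then 𝟙 c else 0) ≡ 𝟙 (b ∧ c)
if-𝟙 true  c = refl
if-𝟙 false c = refl

¬T⇒≡false : ∀ {b} → ¬ T b → b ≡ false
¬T⇒≡false {false} _  = refl
¬T⇒≡false {true}  ¬t = ⊥-elim (¬t _)

<ᵇ-true : ∀ {m n} → m < n → (m <ᵇ n) ≡ true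
<ᵇ-true m<n = Equivalence.to T-≡ (<⇒<ᵇ m<n)

<ᵇ-false : ∀ {m n} → n ≤ m → (m <ᵇ n) ≡ false
<ᵇ-false {m} {n} n≤m = ¬T⇒≡false (≤⇒≯ n≤m ∘ <ᵇ⇒< m n)

≤ᵇ-true : ∀ {m n} → m ≤ n → (m ≤ᵇ n) ≡ true
≤ᵇ-true m≤n = Equivalence.to T-≡ (≤⇒≤ᵇ m≤n)

≤ᵇ-false : ∀ {m n} → n < m → (m ≤ᵇ n) ≡ false
≤ᵇ-false {m} {n} n<m = ¬T⇒≡false (<⇒≱ n<m ∘ ≤ᵇ⇒≤ m n)

≡ᵇ-true : ∀ n → (n ≡ᵇ n) ≡ true
≡ᵇ-true n = Equivalence.to T-≡ (≡⇒≡ᵇ n n refl)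

≡ᵇ-false : ∀ {m n} → m ≢ n → (m ≡ᵇ n) ≡ false
≡ᵇ-false {m} {n} m≢n = ¬T⇒≡false (m≢n ∘ ≡ᵇ⇒≡ m n)

≤ᵇ≡<ᵇ-suc : ∀ m n → (m ≤ᵇ n) ≡ (m <ᵇ suc n)
≤ᵇ≡<ᵇ-suc zero    n = refl
≤ᵇ≡<ᵇ-suc (suc m) n = refl

∧-cong-guarded : ∀ {b c c′} → (T b → c ≡ c′) → b ∧ c ≡ b ∧ c′
∧-cong-guarded {false} _  = refl
∧-cong-guarded {true}  eq = cong (true ∧_) (eq _)

∧-falseˡ : ∀ {b c} → b ≡ false → b ∧ c ≡ false
∧-falseˡ refl = refl

+-≡ᵇ0 : ∀ m n → (m + n ≡ᵇ 0) ≡ (m ≡ᵇ 0) ∧ (n ≡ᵇ 0)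
+-≡ᵇ0 zero    n = refl
+-≡ᵇ0 (suc m) n = refl

+-≡ᵇ : ∀ m n r → (m + n ≡ᵇ r) ≡ (m ≤ᵇ r) ∧ (n ≡ᵇ r ∸ m)
+-≡ᵇ zero    n r       = refl
+-≡ᵇ (suc m) n zero    = refl
+-≡ᵇ (suc m) n (suc r) = trans (+-≡ᵇ m n r) (cong (_∧ (n ≡ᵇ r ∸ m)) (≤ᵇ≡<ᵇ-suc m r))

count : (A → Bool) → List A → ℕ
count p []       = 0
count p (x ∷ xs) = 𝟙 (p x) + count p xs

pairCount : (A → A → Bool) → List A → ℕ
pairCount Q []       = 0
pairCount Q (x ∷ xs) = count (Q x) xs + pairCount Q xs

tripleCount : (A → A → A → Bool) → List A → ℕ
tripleCount P []       = 0
tripleCount P (x ∷ xs) = pairCount (P x) xs + tripleCount P xs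

count-congᴬ : ∀ {P : A → Set} {p q} {xs} → All P xs → (∀ x → P x → p x ≡ q x) →
              count p xs ≡ count q xs
count-congᴬ []         _  = refl
count-congᴬ (Px ∷ Pxs) eq = cong₂ _+_ (cong 𝟙 (eq _ Px)) (count-congᴬ Pxs eq)

count-cong : ∀ {p q : A → Bool} xs → (∀ x → p x ≡ q x) → count p xs ≡ count q xs
count-cong []       eq = refl
count-cong (x ∷ xs) eq = cong₂ _+_ (cong 𝟙 (eq x)) (count-cong xs eq)

pairCount-cong : ∀ {Q Q′ : A → A → Bool} xs → (∀ x y → Q x y ≡ Q′ x y) →
                 pairCount Q xs ≡ pairCount Q′ xs
pairCount-cong []       eq = refl
pairCount-cong (x ∷ xs) eq = cong₂ _+_ (count-cong xs (eq x)) (pairCount-cong xs eq)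

tripleCount-cong : ∀ {P P′ : A → A → A → Bool} xs → (∀ x y z → P x y z ≡ P′ x y z) →
                   tripleCount P xs ≡ tripleCount P′ xs
tripleCount-cong []       eq = refl
tripleCount-cong (x ∷ xs) eq = cong₂ _+_ (pairCount-cong xs (eq x)) (tripleCount-cong xs eq)

count-map : ∀ (p : B → Bool) (f : A → B) xs → count p (map f xs) ≡ count (p ∘ f) xs
count-map p f []       = refl
count-map p f (x ∷ xs) = cong (𝟙 (p (f x)) +_) (count-map p f xs)

pairCount-map : ∀ (Q : B → B → Bool) (f : A → B) xs →
                pairCount Q (map f xs) ≡ pairCount (λ x y → Q (f x) (f y)) xs
pairCount-map Q f []       = refl
pairCount-map Q f (x ∷ xs) = cong₂ _+_ (count-map (Q (f x)) f xs) (pairCount-map Q f xs)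

tripleCount-map : ∀ (P : B → B → B → Bool) (f : A → B) xs →
                  tripleCount P (map f xs) ≡ tripleCount (λ x y z → P (f x) (f y) (f z)) xs
tripleCount-map P f []       = refl
tripleCount-map P f (x ∷ xs) = cong₂ _+_ (pairCount-map (P (f x)) f xs) (tripleCount-map P f xs)

count-mono : ∀ {p q : A → Bool} xs → (∀ x → T (p x) → T (q x)) → count p xs ≤ count q xs
count-mono []       p⇒q = z≤n
count-mono (x ∷ xs) p⇒q = +-mono-≤ (𝟙-mono (p⇒q x)) (count-mono xs p⇒q)

pairCount-mono : ∀ {Q Q′ : A → A → Bool} xs → (∀ x y → T (Q x y) → T (Q′ x y)) →
                 pairCount Q xs ≤ pairCount Q′ xs
pairCount-mono []       Q⇒Q′ = z≤n
pairCount-mono (x ∷ xs) Q⇒Q′ = +-mono-≤ (count-mono xs (Q⇒Q′ x)) (pairCount-mono xs Q⇒Q′)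

count-false : ∀ {p : A → Bool} xs → (∀ x → p x ≡ false) → count p xs ≡ 0
count-false []       _  = refl
count-false (x ∷ xs) px rewrite px x = count-false xs px

count-+ : ∀ {p q r : A → Bool} xs → (∀ x → 𝟙 (p x) ≡ 𝟙 (q x) + 𝟙 (r x)) →
          count p xs ≡ count q xs + count r xs
count-+ []       _ = refl
count-+ {q = q} {r} (x ∷ xs) split rewrite split x | count-+ xs split =
  interchange (𝟙 (q x)) (𝟙 (r x)) (count q xs) (count r xs)

count-complement : ∀ {p q : A → Bool} xs → (∀ x → 𝟙 (p x) + 𝟙 (q x) ≡ 1) →
                   count p xs + count q xs ≡ length xs
count-complement []       _ = refl
count-complement {p = p} {q} (x ∷ xs) partition = begin
  (𝟙 (p x) + count p xs) + (𝟙 (q x) + count q xs)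
    ≡⟨ interchange (𝟙 (p x)) (count p xs) (𝟙 (q x)) (count q xs) ⟩
  (𝟙 (p x) + 𝟙 (q x)) + (count p xs + count q xs)
    ≡⟨ cong₂ _+_ (partition x) (count-complement xs partition) ⟩
  suc (length xs) ∎
  where open ≡-Reasoning

inRange : ℕ → ℕ → ℕ → Bool
inRange a b c = (a ≤ᵇ c) ∧ (c <ᵇ b)

T-inRange : ∀ {a b c} → T (inRange a b c) → a ≤ c × c < b
T-inRange {a} {b} {c} t with Equivalence.to T-∧ t
... | a≤ᵇc , c<ᵇb = ≤ᵇ⇒≤ a c a≤ᵇc , <ᵇ⇒< c b c<ᵇb

𝟙-≤ᵇ-split : ∀ {a b} → a ≤ b → ∀ c →
             𝟙 (a ≤ᵇ c) ≡ 𝟙 (inRange a b c) + 𝟙 (b ≤ᵇ c)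
𝟙-≤ᵇ-split {a} {b} a≤b c with <-cmp c b
... | tri< c<b _ _ rewrite <ᵇ-true c<b | ≤ᵇ-false c<b | ∧-identityʳ (a ≤ᵇ c) = sym (+-identityʳ _)
... | tri≈ _ refl _ rewrite ≤ᵇ-true a≤b | ≤ᵇ-true (≤-refl {c}) | <ᵇ-false (≤-refl {c}) = refl
... | tri> _ _ b<c rewrite ≤ᵇ-true (≤-trans a≤b (<⇒≤ b<c)) | <ᵇ-false (<⇒≤ b<c)
                        | ≤ᵇ-true (<⇒≤ b<c) = refl

𝟙-≤ᵇ-≡ᵇ-<ᵇ : ∀ a c → 𝟙 (a ≤ᵇ c) ≡ 𝟙 (a ≡ᵇ c) + 𝟙 (a <ᵇ c)
𝟙-≤ᵇ-≡ᵇ-<ᵇ a c with <-cmp a c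
... | tri< a<c _ _ rewrite ≤ᵇ-true (<⇒≤ a<c) | ≡ᵇ-false (<⇒≢ a<c) | <ᵇ-true a<c = refl
... | tri≈ _ refl _ rewrite ≤ᵇ-true (≤-refl {a}) | ≡ᵇ-true a | <ᵇ-false (≤-refl {a}) = refl
... | tri> _ _ c<a rewrite ≤ᵇ-false c<a | ≡ᵇ-false (≢-sym (<⇒≢ c<a))
                        | <ᵇ-false (<⇒≤ c<a) = refl

𝟙-inRange-suc : ∀ {a b} → a ≤ b → ∀ c →
                𝟙 (inRange a (suc b) c) ≡ 𝟙 (b ≡ᵇ c) + 𝟙 (inRange a b c)
𝟙-inRange-suc {a} {b} a≤b c with <-cmp c b
... | tri< c<b _ _ rewrite <ᵇ-true c<b | <ᵇ-true (m≤n⇒m≤1+n c<b)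
                        | ≡ᵇ-false (≢-sym (<⇒≢ c<b)) = refl
... | tri≈ _ refl _ rewrite ≤ᵇ-true a≤b | <ᵇ-true (n<1+n c) | <ᵇ-false (≤-refl {c})
                        | ≡ᵇ-true c = refl
... | tri> _ _ b<c rewrite <ᵇ-false b<c | <ᵇ-false (<⇒≤ b<c) | ≡ᵇ-false (<⇒≢ b<c)
                        | ∧-zeroʳ (a ≤ᵇ c) = refl

𝟙-≤ᵇ-complement : ∀ x c → 𝟙 (x ≤ᵇ c) + 𝟙 (c <ᵇ x) ≡ 1
𝟙-≤ᵇ-complement x c with <-cmp c x
... | tri< c<x _ _ rewrite ≤ᵇ-false c<x | <ᵇ-true c<x = refl
... | tri≈ _ refl _ rewrite ≤ᵇ-true (≤-refl {c}) | <ᵇ-false (≤-refl {c}) = refl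
... | tri> _ _ x<c rewrite ≤ᵇ-true (<⇒≤ x<c) | <ᵇ-false (<⇒≤ x<c) = refl

drop-zeroˡ : ∀ {m n} → m ≡ 0 → m + n ≡ n
drop-zeroˡ refl = refl

sum-zero : ∀ n {f : Fin n → ℕ} → (∀ i → f i ≡ 0) → sum f ≡ 0
sum-zero n f≡0 = trans (sum-cong-≗ f≡0) (sum-replicate-zero n)

count-tabulate : ∀ k (p : A → Bool) (x : Fin k → A) →
                 ∑[ i < k ] 𝟙 (p (x i)) ≡ count p (tabulate x)
count-tabulate zero    p x = refl
count-tabulate (suc k) p x = cong (𝟙 (p (x 0F)) +_) (count-tabulate k p (x ∘ 1+))

pairCount-tabulate : ∀ k (Q : A → A → Bool) (x : Fin k → A) →
                     ∑[ i < k ] ∑[ j < k ] 𝟙 ((toℕ i <ᵇ toℕ j) ∧ Q (x i) (x j))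
                     ≡ pairCount Q (tabulate x)
pairCount-tabulate zero    Q x = refl
pairCount-tabulate (suc k) Q x =
  cong₂ _+_ (count-tabulate k (Q (x 0F)) (x ∘ 1+)) (pairCount-tabulate k Q (x ∘ 1+))

tripleCount-tabulate : ∀ k (P : A → A → A → Bool) (x : Fin k → A) →
                       ∑[ i < k ] ∑[ j < k ] ∑[ l < k ]
                         𝟙 ((toℕ i <ᵇ toℕ j) ∧ (toℕ j <ᵇ toℕ l) ∧ P (x i) (x j) (x l))
                       ≡ tripleCount P (tabulate x)
tripleCount-tabulate zero    P x = refl
tripleCount-tabulate (suc k) P x = cong₂ _+_
  (trans (drop-zeroˡ (sum-replicate-zero (suc k))) (pairCount-tabulate k (P (x 0F)) (x ∘ 1+)))
  (trans (sum-cong-≗ {k} dropFalse) (tripleCount-tabulate k P (x ∘ 1+)))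
  where
  dropFalse : ∀ i →
    ∑[ j < suc k ] ∑[ l < suc k ]
      𝟙 ((suc (toℕ i) <ᵇ toℕ j) ∧ (toℕ j <ᵇ toℕ l) ∧ P (x (1+ i)) (x j) (x l))
    ≡ ∑[ j < k ] ∑[ l < k ]
      𝟙 ((toℕ i <ᵇ toℕ j) ∧ (toℕ j <ᵇ toℕ l) ∧ P (x (1+ i)) (x (1+ j)) (x (1+ l)))
  dropFalse i = trans (drop-zeroˡ (sum-replicate-zero (suc k)))
                      (sum-cong-≗ {k} λ j → drop-zeroˡ (cong 𝟙 (∧-zeroʳ (toℕ i <ᵇ toℕ j))))

sumL-tabulate : ∀ k (h : Fin k → A) (f : A → ℕ) → sumL (tabulate h) f ≡ ∑[ i < k ] f (h i)
sumL-tabulate zero    h f = refl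
sumL-tabulate (suc k) h f = cong (f (h 0F) +_) (sumL-tabulate k (h ∘ 1+) f)

sumL-allFin : ∀ k (f : Fin k → ℕ) → sumL (allFin k) f ≡ sum f
sumL-allFin k = sumL-tabulate k id

sumL-cong : ∀ (xs : List A) {f g : A → ℕ} → (∀ x → f x ≡ g x) → sumL xs f ≡ sumL xs g
sumL-cong []       eq = refl
sumL-cong (x ∷ xs) eq = cong₂ _+_ (eq x) (sumL-cong xs eq)

sumL-++ : ∀ (xs ys : List A) f → sumL (xs ++ ys) f ≡ sumL xs f + sumL ys f
sumL-++ []       ys f = refl
sumL-++ (x ∷ xs) ys f = trans (cong (f x +_) (sumL-++ xs ys f)) (sym (+-assoc (f x) _ _))

sumL-map : ∀ (g : A → B) xs f → sumL (map g xs) f ≡ sumL xs (f ∘ g)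
sumL-map g []       f = refl
sumL-map g (x ∷ xs) f = cong (f (g x) +_) (sumL-map g xs f)

sumL-concatMap : ∀ (h : A → List B) xs f → sumL (concatMap h xs) f ≡ sumL xs (λ x → sumL (h x) f)
sumL-concatMap h []       f = refl
sumL-concatMap h (x ∷ xs) f =
  trans (sumL-++ (h x) (concatMap h xs) f) (cong (sumL (h x) f +_) (sumL-concatMap h xs f))

sumL-filterᵇ : ∀ (p : A → Bool) xs f →
               sumL (filterᵇ p xs) f ≡ sumL xs (λ x → if p x then f x else 0)
sumL-filterᵇ p []       f = refl
sumL-filterᵇ p (x ∷ xs) f with p x
... | true  = cong (f x +_) (sumL-filterᵇ p xs f)
... | false = sumL-filterᵇ p xs f

length≡sumL : ∀ (xs : List A) → length xs ≡ sumL xs (λ _ → 1)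
length≡sumL []       = refl
length≡sumL (x ∷ xs) = cong suc (length≡sumL xs)

values : ∀ {m k} → Vec (Fin m) k → List ℕ
values v = tabulate (λ i → toℕ (lookup v i))

repeats : List ℕ → ℕ
repeats = pairCount _≡ᵇ_

#123 : List ℕ → ℕ
#123 = tripleCount (λ a b c → (a <ᵇ b) ∧ (b <ᵇ c))

#132 : List ℕ → ℕ
#132 = tripleCount (λ a b c → (a <ᵇ c) ∧ (c <ᵇ b))

countedBy-a : List ℕ → Bool
countedBy-a w = (repeats w ≡ᵇ 0) ∧ (#132 w ≡ᵇ 0) ∧ (#123 w ≡ᵇ 3)

countTriples≡tripleCount : ∀ {n} P (v : Vec (Fin n) n) → countTriples P v ≡ tripleCount P (values v)
countTriples≡tripleCount {n} P v =
  trans (sumL-allFin n _)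
    (trans (sum-cong-≗ {n} λ i → trans (sumL-allFin n _) (sum-cong-≗ {n} λ j → sumL-allFin n _))
      (tripleCount-tabulate n P (λ i → toℕ (lookup v i))))

isPerm≡repeats≡ᵇ0 : ∀ {n} (v : Vec (Fin n) n) → isPerm v ≡ (repeats (values v) ≡ᵇ 0)
isPerm≡repeats≡ᵇ0 {n} v = cong (_≡ᵇ 0)
  (trans (sumL-allFin n _)
    (trans (sum-cong-≗ {n} λ i → sumL-allFin n _)
      (pairCount-tabulate n _≡ᵇ_ (λ i → toℕ (lookup v i)))))

wordSum : ℕ → ℕ → (List ℕ → ℕ) → ℕ
wordSum m zero    f = f []
wordSum m (suc k) f = ∑[ x < m ] wordSum m k (λ w → f (toℕ x ∷ w))

sumL-words : ∀ m k (f : List ℕ → ℕ) → sumL (words (allFin m) k) (f ∘ values) ≡ wordSum m k f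
sumL-words m zero    f = +-identityʳ (f [])
sumL-words m (suc k) f = begin
  sumL (concatMap (λ x → map (x ∷ᵥ_) (words (allFin m) k)) (allFin m)) (f ∘ values)
    ≡⟨ sumL-concatMap (λ x → map (x ∷ᵥ_) (words (allFin m) k)) (allFin m) _ ⟩
  sumL (allFin m) (λ x → sumL (map (x ∷ᵥ_) (words (allFin m) k)) (f ∘ values))
    ≡⟨ sumL-cong (allFin m) (λ x → trans (sumL-map (x ∷ᵥ_) (words (allFin m) k) _)
                                         (sumL-words m k (λ w → f (toℕ x ∷ w)))) ⟩
  sumL (allFin m) (λ x → wordSum m k (λ w → f (toℕ x ∷ w)))
    ≡⟨ sumL-allFin m _ ⟩
  wordSum m (suc k) f ∎
  where open ≡-Reasoning

a≡wordSum : ∀ n → a n ≡ wordSum n n (λ w → 𝟙 (countedBy-a w))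
a≡wordSum n = begin
  length (filterᵇ avoids (filterᵇ isPerm W))
    ≡⟨ length≡sumL (filterᵇ avoids (filterᵇ isPerm W)) ⟩
  sumL (filterᵇ avoids (filterᵇ isPerm W)) (λ _ → 1)
    ≡⟨ sumL-filterᵇ avoids (filterᵇ isPerm W) _ ⟩
  sumL (filterᵇ isPerm W) (λ v → 𝟙 (avoids v))
    ≡⟨ sumL-filterᵇ isPerm W _ ⟩
  sumL W (λ v → if isPerm v then 𝟙 (avoids v) else 0)
    ≡⟨ sumL-cong W onValues ⟩
  sumL W (λ v → 𝟙 (countedBy-a (values v)))
    ≡⟨ sumL-words n n _ ⟩
  wordSum n n (λ w → 𝟙 (countedBy-a w)) ∎
  where
  open ≡-Reasoning
  W = words (allFin n) n
  avoids : Vec (Fin n) n → Bool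
  avoids π = (occ132 π ≡ᵇ 0) ∧ (occ123 π ≡ᵇ 3)
  onValues : ∀ v → (if isPerm v then 𝟙 (avoids v) else 0) ≡ 𝟙 (countedBy-a (values v))
  onValues v = trans (if-𝟙 (isPerm v) (avoids v))
    (cong 𝟙 (cong₂ _∧_ (isPerm≡repeats≡ᵇ0 v)
      (cong₂ _∧_ (cong (_≡ᵇ 0) (countTriples≡tripleCount _ v))
                 (cong (_≡ᵇ 3) (countTriples≡tripleCount _ v)))))

wordSum-cong : ∀ m k {f g : List ℕ → ℕ} →
               (∀ w → All (_< m) w → length w ≡ k → f w ≡ g w) → wordSum m k f ≡ wordSum m k g
wordSum-cong m zero    eq = eq [] [] refl
wordSum-cong m (suc k) eq = sum-cong-≗ {m} λ x →
  wordSum-cong m k λ w w<m ∣w∣≡k → eq (toℕ x ∷ w) (toℕ<n x ∷ w<m) (cong suc ∣w∣≡k)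

wordSum-zero : ∀ m k {f : List ℕ → ℕ} → (∀ w → f w ≡ 0) → wordSum m k f ≡ 0
wordSum-zero m zero    f≡0 = f≡0 []
wordSum-zero m (suc k) f≡0 = sum-zero m λ x → wordSum-zero m k λ w → f≡0 (toℕ x ∷ w)

wordSum-if : ∀ m k b (f : List ℕ → ℕ) →
             wordSum m k (λ w → if b then f w else 0) ≡ (if b then wordSum m k f else 0)
wordSum-if m k true  f = refl
wordSum-if m k false f = wordSum-zero m k λ _ → refl

punchIn : ℕ → ℕ → ℕ
punchIn zero    j       = suc j
punchIn (suc i) zero    = zero
punchIn (suc i) (suc j) = suc (punchIn i j)

toℕ-punchIn : ∀ {m} (i : Fin (suc m)) (j : Fin m) →
              toℕ (Fin.punchIn i j) ≡ punchIn (toℕ i) (toℕ j)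
toℕ-punchIn 0F     j      = refl
toℕ-punchIn (1+ i) 0F     = refl
toℕ-punchIn (1+ i) (1+ j) = cong suc (toℕ-punchIn i j)

wordSum-punchIn : ∀ m k x {f : List ℕ → ℕ} → x < suc m →
                  (∀ pre w → f (pre ++ x ∷ w) ≡ 0) →
                  wordSum (suc m) k f ≡ wordSum m k (f ∘ map (punchIn x))
wordSum-punchIn m zero    x x<1+m killed = refl
wordSum-punchIn m (suc k) x {f} x<1+m killed = begin
  ∑[ y < suc m ] wordSum (suc m) k (λ w → f (toℕ y ∷ w))
    ≡⟨ sum-remove {i = i} (λ y → wordSum (suc m) k (λ w → f (toℕ y ∷ w))) ⟩
  wordSum (suc m) k (λ w → f (toℕ i ∷ w))
    + ∑[ y < m ] wordSum (suc m) k (λ w → f (toℕ (Fin.punchIn i y) ∷ w))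
    ≡⟨ drop-zeroˡ (wordSum-zero (suc m) k λ w →
         subst (λ z → f (z ∷ w) ≡ 0) (sym (toℕ-fromℕ< x<1+m)) (killed [] w)) ⟩
  ∑[ y < m ] wordSum (suc m) k (λ w → f (toℕ (Fin.punchIn i y) ∷ w))
    ≡⟨ sum-cong-≗ {m} (λ y → trans
         (cong (λ z → wordSum (suc m) k (λ w → f (z ∷ w))) (toℕ-punchIn-x y))
         (wordSum-punchIn m k x x<1+m λ pre w → killed (punchIn x (toℕ y) ∷ pre) w)) ⟩
  ∑[ y < m ] wordSum m k (λ u → f (punchIn x (toℕ y) ∷ map (punchIn x) u)) ∎
  where
  open ≡-Reasoning
  i = fromℕ< x<1+m
  toℕ-punchIn-x : ∀ y → toℕ (Fin.punchIn i y) ≡ punchIn x (toℕ y)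
  toℕ-punchIn-x y = trans (toℕ-punchIn i y) (cong (λ z → punchIn z (toℕ y)) (toℕ-fromℕ< x<1+m))

record IsPermutation (m : ℕ) (u : List ℕ) : Set where
  field
    noRepeats : repeats u ≡ 0
    bounded   : All (_< m) u
    length≡m  : length u ≡ m

count-≡ᵇ-pos : ∀ x pre w → 0 < count (x ≡ᵇ_) (pre ++ x ∷ w)
count-≡ᵇ-pos x []        w rewrite ≡ᵇ-true x = s≤s z≤n
count-≡ᵇ-pos x (a ∷ pre) w = ≤-trans (count-≡ᵇ-pos x pre w) (m≤n+m _ _)

count-≡ᵇ-≤1 : ∀ u → repeats u ≡ 0 → ∀ b → count (b ≡ᵇ_) u ≤ 1
count-≡ᵇ-≤1 []      _   b = z≤n
count-≡ᵇ-≤1 (a ∷ u) r≡0 b with b ≟ a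
... | yes refl rewrite ≡ᵇ-true b | m+n≡0⇒m≡0 (count (b ≡ᵇ_) u) r≡0 = ≤-refl
... | no b≢a   rewrite ≡ᵇ-false b≢a = count-≡ᵇ-≤1 u (m+n≡0⇒n≡0 (count (a ≡ᵇ_) u) r≡0) b

count-inRange-≤ : ∀ u → repeats u ≡ 0 → ∀ a b → count (inRange a b) u ≤ b ∸ a
count-inRange-≤ u r≡0 a zero =
  ≤-trans (≤-reflexive (count-false u λ c → ∧-zeroʳ (a ≤ᵇ c))) z≤n
count-inRange-≤ u r≡0 a (suc b) with a ≤? b
... | yes a≤b = begin
  count (inRange a (suc b)) u
    ≡⟨ count-+ u (𝟙-inRange-suc a≤b) ⟩
  count (b ≡ᵇ_) u + count (inRange a b) u
    ≤⟨ +-mono-≤ (count-≡ᵇ-≤1 u r≡0 b) (count-inRange-≤ u r≡0 a b) ⟩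
  suc (b ∸ a)
    ≡⟨ sym (+-∸-assoc 1 a≤b) ⟩
  suc b ∸ a ∎
  where open ≤-Reasoning
... | no a≰b = ≤-trans (≤-reflexive (count-false u λ c → ¬T⇒≡false λ t →
                 let (a≤c , c<1+b) = T-inRange t in a≰b (≤-trans a≤c (≤-pred c<1+b)))) z≤n

-- At most x entries lie below x and at most m ∸ x in [x, m); together they are all m entries.
count-≥ : ∀ {m u} → IsPermutation m u → ∀ {x} → x ≤ m → count (x ≤ᵇ_) u ≡ m ∸ x
count-≥ {m} {u} π {x} x≤m = ≤-antisym above≤ above≥
  where
  open IsPermutation π
  above = count (x ≤ᵇ_) u
  below = count (_<ᵇ x) u
  above+below : above + below ≡ m
  above+below = trans (count-complement u (𝟙-≤ᵇ-complement x)) length≡m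
  above≤ : above ≤ m ∸ x
  above≤ = ≤-trans (≤-reflexive (count-congᴬ bounded λ c c<m →
                     sym (trans (cong ((x ≤ᵇ c) ∧_) (<ᵇ-true c<m)) (∧-identityʳ _))))
                   (count-inRange-≤ u noRepeats x m)
  above≥ : m ∸ x ≤ above
  above≥ = ≤-trans (∸-monoʳ-≤ m (count-inRange-≤ u noRepeats 0 x))
                   (≤-reflexive (trans (cong (_∸ below) (sym above+below)) (m+n∸n≡m above below)))

count-inRange-pos : ∀ {m u} → IsPermutation m u → ∀ {a b} → a < b → b ≤ m →
                    0 < count (inRange a b) u
count-inRange-pos {m} {u} π {a} {b} a<b b≤m =
  subst (0 <_) (sym between≡) (m<n⇒0<n∸m (∸-monoʳ-< a<b b≤m))
  where
  between = count (inRange a b) u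
  split : m ∸ a ≡ between + (m ∸ b)
  split = begin
    m ∸ a                          ≡⟨ sym (count-≥ π (≤-trans (<⇒≤ a<b) b≤m)) ⟩
    count (a ≤ᵇ_) u                ≡⟨ count-+ u (𝟙-≤ᵇ-split (<⇒≤ a<b)) ⟩
    between + count (b ≤ᵇ_) u      ≡⟨ cong (between +_) (count-≥ π b≤m) ⟩
    between + (m ∸ b)              ∎
    where open ≡-Reasoning
  between≡ : between ≡ (m ∸ a) ∸ (m ∸ b)
  between≡ = sym (trans (cong (_∸ (m ∸ b)) split) (m+n∸n≡m between (m ∸ b)))

-- Removing the first entry

inversions≥ : ℕ → List ℕ → ℕ
inversions≥ t = pairCount (λ b c → inRange t b c)

coinversions≥ : ℕ → List ℕ → ℕ
coinversions≥ t = pairCount (λ b c → inRange t c b)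

coinversions≥≡C₂ : ∀ x u → repeats u ≡ 0 → inversions≥ x u ≡ 0 →
                   coinversions≥ x u ≡ count (x ≤ᵇ_) u C 2
coinversions≥≡C₂ x []      _   _   = refl
coinversions≥≡C₂ x (a ∷ u) r≡0 i≡0 with x ≤? a
... | yes x≤a rewrite ≤ᵇ-true x≤a = begin
  count (a <ᵇ_) u + coinversions≥ x u  ≡⟨ cong₂ _+_ larger≡ IH ⟩
  k + k C 2                            ≡⟨ cong (_+ k C 2) (sym (nC1≡n k)) ⟩
  k C 1 + k C 2                        ≡⟨ nCk+nC[k+1]≡[n+1]C[k+1] k 1 ⟩
  suc k C 2                            ∎
  where
  open ≡-Reasoning
  k = count (x ≤ᵇ_) u
  IH = coinversions≥≡C₂ x u (m+n≡0⇒n≡0 _ r≡0) (m+n≡0⇒n≡0 _ i≡0)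
  larger≡ : count (a <ᵇ_) u ≡ k
  larger≡ = sym (begin
    k                                        ≡⟨ count-+ u (𝟙-≤ᵇ-split x≤a) ⟩
    count (inRange x a) u + count (a ≤ᵇ_) u  ≡⟨ drop-zeroˡ (m+n≡0⇒m≡0 _ i≡0) ⟩
    count (a ≤ᵇ_) u                          ≡⟨ count-+ u (𝟙-≤ᵇ-≡ᵇ-<ᵇ a) ⟩
    count (a ≡ᵇ_) u + count (a <ᵇ_) u        ≡⟨ drop-zeroˡ (m+n≡0⇒m≡0 _ r≡0) ⟩
    count (a <ᵇ_) u                          ∎)
... | no x≰a rewrite ≤ᵇ-false (≰⇒> x≰a) =
  trans (drop-zeroˡ (count-false u λ _ → refl))
        (coinversions≥≡C₂ x u (m+n≡0⇒n≡0 _ r≡0) (m+n≡0⇒n≡0 _ i≡0))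

inversions≥-bounded : ∀ {t w} → All (_< t) w → inversions≥ t w ≡ 0
inversions≥-bounded []                       = refl
inversions≥-bounded {t} {b ∷ w} (_ ∷ w<t) = cong₂ _+_
  (trans (count-congᴬ w<t λ c c<t → cong (_∧ (c <ᵇ b)) (≤ᵇ-false c<t)) (count-false w λ _ → refl))
  (inversions≥-bounded w<t)

punchIn-<ᵇ : ∀ x a b → (punchIn x a <ᵇ punchIn x b) ≡ (a <ᵇ b)
punchIn-<ᵇ zero    a       b       = refl
punchIn-<ᵇ (suc x) zero    zero    = refl
punchIn-<ᵇ (suc x) zero    (suc b) = refl
punchIn-<ᵇ (suc x) (suc a) zero    = refl
punchIn-<ᵇ (suc x) (suc a) (suc b) = punchIn-<ᵇ x a b

punchIn-≡ᵇ : ∀ x a b → (punchIn x a ≡ᵇ punchIn x b) ≡ (a ≡ᵇ b)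
punchIn-≡ᵇ zero    a       b       = refl
punchIn-≡ᵇ (suc x) zero    zero    = refl
punchIn-≡ᵇ (suc x) zero    (suc b) = refl
punchIn-≡ᵇ (suc x) (suc a) zero    = refl
punchIn-≡ᵇ (suc x) (suc a) (suc b) = punchIn-≡ᵇ x a b

≡ᵇ-punchIn : ∀ x c → (x ≡ᵇ punchIn x c) ≡ false
≡ᵇ-punchIn zero    c       = refl
≡ᵇ-punchIn (suc x) zero    = refl
≡ᵇ-punchIn (suc x) (suc c) = ≡ᵇ-punchIn x c

<ᵇ-punchIn : ∀ x c → (x <ᵇ punchIn x c) ≡ (x ≤ᵇ c)
<ᵇ-punchIn zero    c       = refl
<ᵇ-punchIn (suc x) zero    = refl
<ᵇ-punchIn (suc x) (suc c) = trans (<ᵇ-punchIn x c) (≤ᵇ≡<ᵇ-suc x c)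

punchIn-< : ∀ {x c} → c < x → punchIn x c ≡ c
punchIn-< {suc x} {zero}  _         = refl
punchIn-< {suc x} {suc c} (s≤s c<x) = cong suc (punchIn-< c<x)

punchIn-≥ : ∀ {x c} → x ≤ c → punchIn x c ≡ suc c
punchIn-≥ {zero}          _         = refl
punchIn-≥ {suc x} {suc c} (s≤s x≤c) = cong suc (punchIn-≥ x≤c)

inRange-punchIn : ∀ a x c → inRange a x (punchIn x c) ≡ inRange a x c
inRange-punchIn a x c with c <? x
... | yes c<x rewrite punchIn-< c<x = refl
... | no c≮x rewrite punchIn-≥ (≮⇒≥ c≮x) | <ᵇ-false (≮⇒≥ c≮x)
                   | <ᵇ-false (m≤n⇒m≤1+n (≮⇒≥ c≮x)) = trans (∧-zeroʳ _) (sym (∧-zeroʳ _))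

repeats-punchIn : ∀ x u → repeats (x ∷ map (punchIn x) u) ≡ repeats u
repeats-punchIn x u = cong₂ _+_
  (trans (count-map (x ≡ᵇ_) (punchIn x) u) (count-false u (≡ᵇ-punchIn x)))
  (trans (pairCount-map _≡ᵇ_ (punchIn x) u) (pairCount-cong u (punchIn-≡ᵇ x)))

#132-punchIn : ∀ x u → #132 (x ∷ map (punchIn x) u) ≡ inversions≥ x u + #132 u
#132-punchIn x u = cong₂ _+_
  (trans (pairCount-map _ (punchIn x) u)
         (pairCount-cong u λ b c → cong₂ _∧_ (<ᵇ-punchIn x c) (punchIn-<ᵇ x c b)))
  (trans (tripleCount-map _ (punchIn x) u)
         (tripleCount-cong u λ a b c → cong₂ _∧_ (punchIn-<ᵇ x a c) (punchIn-<ᵇ x c b)))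

#123-punchIn : ∀ x u → #123 (x ∷ map (punchIn x) u) ≡ coinversions≥ x u + #123 u
#123-punchIn x u = cong₂ _+_
  (trans (pairCount-map _ (punchIn x) u)
         (pairCount-cong u λ b c → cong₂ _∧_ (<ᵇ-punchIn x b) (punchIn-<ᵇ x b c)))
  (trans (tripleCount-map _ (punchIn x) u)
         (tripleCount-cong u λ a b c → cong₂ _∧_ (punchIn-<ᵇ x a b) (punchIn-<ᵇ x b c)))

inversions≥-punchIn-≤ : ∀ {x t} u → x ≤ t →
                        inversions≥ t (x ∷ map (punchIn x) u) ≤ inversions≥ x u
inversions≥-punchIn-≤ {x} {t} u x≤t = begin
  count (inRange t x) (map (punchIn x) u) + inversions≥ t (map (punchIn x) u)
    ≡⟨ drop-zeroˡ (count-false (map (punchIn x) u) λ c → ¬T⇒≡false λ t≤c<x →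
         let (t≤c , c<x) = T-inRange t≤c<x in <⇒≱ c<x (≤-trans x≤t t≤c)) ⟩
  inversions≥ t (map (punchIn x) u)
    ≡⟨ pairCount-map _ (punchIn x) u ⟩
  pairCount (λ b c → inRange t (punchIn x b) (punchIn x c)) u
    ≤⟨ pairCount-mono u shrink ⟩
  inversions≥ x u ∎
  where
  open ≤-Reasoning
  shrink : ∀ b c → T (inRange t (punchIn x b) (punchIn x c)) → T (inRange x b c)
  shrink b c inside with T-inRange {t} {punchIn x b} {punchIn x c} inside
  ... | t≤c′ , c′<b′ =
    Equivalence.from T-∧ (≤⇒≤ᵇ x≤c , subst T (punchIn-<ᵇ x c b) (<⇒<ᵇ c′<b′))
    where
    x≤c : x ≤ c
    x≤c with c <? x
    ... | yes c<x = ⊥-elim (<⇒≱ c<x (≤-trans x≤t (subst (t ≤_) (punchIn-< c<x) t≤c′)))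
    ... | no  c≮x = ≮⇒≥ c≮x

inversions≥-punchIn-pos : ∀ {m u} → IsPermutation m u → ∀ {t x} → t < x → x ≤ m →
                          0 < inversions≥ t (x ∷ map (punchIn x) u)
inversions≥-punchIn-pos {u = u} π {t} {x} t<x x≤m =
  ≤-trans (count-inRange-pos π t<x x≤m) (≤-trans (≤-reflexive entries≡) (m≤m+n _ _))
  where
  entries≡ : count (inRange t x) u ≡ count (inRange t x) (map (punchIn x) u)
  entries≡ = sym (trans (count-map (inRange t x) (punchIn x) u) (count-cong u (inRange-punchIn t x)))

-- The g largest entries of x ∷ … are all ≥ x iff g ≤ suc (m ∸ x); otherwise one of them lies
-- below x and comes after it.
inversions≥-punchIn-≡ᵇ0 : ∀ {m u} → IsPermutation m u → ∀ {x g} → x ≤ m → g ≤ suc m →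
  inversions≥ x u ≡ 0 →
  (inversions≥ (suc m ∸ g) (x ∷ map (punchIn x) u) ≡ᵇ 0) ≡ (g ≤ᵇ suc (m ∸ x))
inversions≥-punchIn-≡ᵇ0 {m} {u} π {x} {g} x≤m g≤1+m i≡0 with g ≤? suc (m ∸ x)
... | yes g≤ rewrite ≤ᵇ-true g≤ =
  cong (_≡ᵇ 0) (n≤0⇒n≡0 (≤-trans (inversions≥-punchIn-≤ u x≤t) (≤-reflexive i≡0)))
  where
  x≤t : x ≤ suc m ∸ g
  x≤t = ≤-trans (≤-reflexive (sym (m∸[m∸n]≡n x≤m))) (∸-monoʳ-≤ (suc m) g≤)
... | no g≰ rewrite ≤ᵇ-false (≰⇒> g≰) =
  ≡ᵇ-false (≢-sym (<⇒≢ (inversions≥-punchIn-pos π t<x x≤m)))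
  where
  t<x : suc m ∸ g < x
  t<x = ≤-trans (∸-monoʳ-< (≰⇒> g≰) g≤1+m) (≤-reflexive (m∸[m∸n]≡n x≤m))

-- The third conjunct says that the g largest entries occur in increasing order.
admissible : ℕ → ℕ → ℕ → List ℕ → Bool
admissible n g r w =
  (repeats w ≡ᵇ 0) ∧ (#132 w ≡ᵇ 0) ∧ (inversions≥ (n ∸ g) w ≡ᵇ 0) ∧ (#123 w ≡ᵇ r)

admissible-punchIn : ∀ {m u} → All (_< m) u → length u ≡ m →
  ∀ {x g} → x ≤ m → g ≤ suc m → ∀ r →
  admissible (suc m) g r (x ∷ map (punchIn x) u)
  ≡ ((g ≤ᵇ suc (m ∸ x)) ∧ ((m ∸ x) C 2 ≤ᵇ r)) ∧ admissible m (m ∸ x) (r ∸ (m ∸ x) C 2) u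
admissible-punchIn {m} {u} u<m ∣u∣≡m {x} {g} x≤m g≤1+m r = begin
  (repeats w ≡ᵇ 0) ∧ (#132 w ≡ᵇ 0) ∧ (I ≡ᵇ 0) ∧ (#123 w ≡ᵇ r)
    ≡⟨ cong₂ _∧_ (cong (_≡ᵇ 0) (repeats-punchIn x u))
         (cong₂ (λ σ τ → σ ∧ (I ≡ᵇ 0) ∧ τ)
           (trans (cong (_≡ᵇ 0) (#132-punchIn x u)) (+-≡ᵇ0 D P))
           (cong (_≡ᵇ r) (#123-punchIn x u))) ⟩
  (R ≡ᵇ 0) ∧ ((D ≡ᵇ 0) ∧ (P ≡ᵇ 0)) ∧ (I ≡ᵇ 0) ∧ (K + Q ≡ᵇ r)
    ≡⟨ cong ((R ≡ᵇ 0) ∧_) (∧-assoc (D ≡ᵇ 0) (P ≡ᵇ 0) _) ⟩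
  (R ≡ᵇ 0) ∧ (D ≡ᵇ 0) ∧ (P ≡ᵇ 0) ∧ (I ≡ᵇ 0) ∧ (K + Q ≡ᵇ r)
    ≡⟨ ∧-cong-guarded (λ R≡0 → ∧-cong-guarded λ D≡0 → cong ((P ≡ᵇ 0) ∧_) (cong₂ _∧_
         (inversions≥-punchIn-≡ᵇ0 (π R≡0) x≤m g≤1+m (≡ᵇ⇒≡ D 0 D≡0))
         (trans (cong (λ y → y + Q ≡ᵇ r) (K≡Cₕ R≡0 D≡0)) (+-≡ᵇ Cₕ Q r)))) ⟩
  (R ≡ᵇ 0) ∧ (D ≡ᵇ 0) ∧ (P ≡ᵇ 0) ∧ γ ∧ (Cₕ ≤ᵇ r) ∧ (Q ≡ᵇ r ∸ Cₕ)
    ≡⟨ solve 6 (λ ρ δ π γ κ ψ → ρ ⊕ (δ ⊕ (π ⊕ (γ ⊕ (κ ⊕ ψ))))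
                                 ⊜ (γ ⊕ κ) ⊕ (ρ ⊕ (π ⊕ (δ ⊕ ψ))))
               refl (R ≡ᵇ 0) (D ≡ᵇ 0) (P ≡ᵇ 0) γ (Cₕ ≤ᵇ r) (Q ≡ᵇ r ∸ Cₕ) ⟩
  (γ ∧ (Cₕ ≤ᵇ r)) ∧ (R ≡ᵇ 0) ∧ (P ≡ᵇ 0) ∧ (D ≡ᵇ 0) ∧ (Q ≡ᵇ r ∸ Cₕ)
    ≡⟨ cong (λ y → (γ ∧ (Cₕ ≤ᵇ r)) ∧ (R ≡ᵇ 0) ∧ (P ≡ᵇ 0) ∧ (inversions≥ y u ≡ᵇ 0)
                   ∧ (Q ≡ᵇ r ∸ Cₕ))
            (sym (m∸[m∸n]≡n x≤m)) ⟩
  (γ ∧ (Cₕ ≤ᵇ r)) ∧ admissible m (m ∸ x) (r ∸ Cₕ) u ∎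
  where
  open ≡-Reasoning
  w = x ∷ map (punchIn x) u
  I = inversions≥ (suc m ∸ g) w
  R = repeats u
  D = inversions≥ x u
  P = #132 u
  K = coinversions≥ x u
  Q = #123 u
  Cₕ = (m ∸ x) C 2
  γ = g ≤ᵇ suc (m ∸ x)
  π : T (R ≡ᵇ 0) → IsPermutation m u
  π R≡0 = record { noRepeats = ≡ᵇ⇒≡ R 0 R≡0 ; bounded = u<m ; length≡m = ∣u∣≡m }
  K≡Cₕ : T (R ≡ᵇ 0) → T (D ≡ᵇ 0) → K ≡ Cₕ
  K≡Cₕ R≡0 D≡0 = trans (coinversions≥≡C₂ x u (≡ᵇ⇒≡ R 0 R≡0) (≡ᵇ⇒≡ D 0 D≡0))
                      (cong (_C 2) (count-≥ (π R≡0) x≤m))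

admissible-repeated : ∀ n g r x pre w → admissible n g r (x ∷ pre ++ x ∷ w) ≡ false
admissible-repeated n g r x pre w =
  ∧-falseˡ (≡ᵇ-false (≢-sym (<⇒≢ (≤-trans (count-≡ᵇ-pos x pre w) (m≤m+n _ _)))))

-- avoiders n g r counts the admissible permutations of length n (wordSum-admissible), and
-- avoidersByFirst m g r h those of length suc m whose first entry has h larger entries.
mutual
  avoiders : ℕ → ℕ → ℕ → ℕ
  avoiders zero    g r = 𝟙 (0 ≡ᵇ r)
  avoiders (suc m) g r = ∑[ h < suc m ] avoidersByFirst m g r (toℕ h)

  avoidersByFirst : ℕ → ℕ → ℕ → ℕ → ℕ
  avoidersByFirst m g r h = if (g ≤ᵇ suc h) ∧ (h C 2 ≤ᵇ r) then avoiders m h (r ∸ h C 2) else 0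

wordSum-admissible : ∀ n g r → g ≤ n → wordSum n n (𝟙 ∘ admissible n g r) ≡ avoiders n g r
wordSum-admissible zero    g r _      = refl
wordSum-admissible (suc m) g r g≤1+m = begin
  ∑[ x < suc m ] wordSum (suc m) m (λ w → 𝟙 (admissible (suc m) g r (toℕ x ∷ w)))
    ≡⟨ sum-cong-≗ {suc m} (λ x → byFirst (toℕ x) (toℕ<n x)) ⟩
  ∑[ x < suc m ] avoidersByFirst m g r (m ∸ toℕ x)
    ≡⟨ sym (sum-cong-≗ {suc m} λ h → cong (avoidersByFirst m g r) (opposite-prop h)) ⟩
  ∑[ h < suc m ] avoidersByFirst m g r (toℕ (Fin.opposite h))
    ≡⟨ sym (sum-permute (λ h → avoidersByFirst m g r (toℕ h)) reverse) ⟩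
  ∑[ h < suc m ] avoidersByFirst m g r (toℕ h) ∎
  where
  open ≡-Reasoning
  byFirst : ∀ x → x < suc m →
            wordSum (suc m) m (λ w → 𝟙 (admissible (suc m) g r (x ∷ w)))
            ≡ avoidersByFirst m g r (m ∸ x)
  byFirst x x<1+m = begin
    wordSum (suc m) m (λ w → 𝟙 (admissible (suc m) g r (x ∷ w)))
      ≡⟨ wordSum-punchIn m m x x<1+m (λ pre w → cong 𝟙 (admissible-repeated (suc m) g r x pre w)) ⟩
    wordSum m m (λ u → 𝟙 (admissible (suc m) g r (x ∷ map (punchIn x) u)))
      ≡⟨ wordSum-cong m m (λ u u<m ∣u∣≡m → trans
           (cong 𝟙 (admissible-punchIn u<m ∣u∣≡m (≤-pred x<1+m) g≤1+m r))
           (sym (if-𝟙 fits _))) ⟩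
    wordSum m m (λ u → if fits then 𝟙 (admissible m h (r ∸ h C 2) u) else 0)
      ≡⟨ wordSum-if m m fits _ ⟩
    (if fits then wordSum m m (𝟙 ∘ admissible m h (r ∸ h C 2)) else 0)
      ≡⟨ cong (λ y → if fits then y else 0) (wordSum-admissible m h (r ∸ h C 2) (m∸n≤m m x)) ⟩
    avoidersByFirst m g r h ∎
    where
    h = m ∸ x
    fits = (g ≤ᵇ suc h) ∧ (h C 2 ≤ᵇ r)

a≡avoiders : ∀ n → a n ≡ avoiders n 0 3
a≡avoiders n = begin
  a n
    ≡⟨ a≡wordSum n ⟩
  wordSum n n (λ w → 𝟙 (countedBy-a w))
    ≡⟨ wordSum-cong n n (λ w w<n _ →
         cong (λ i → 𝟙 ((repeats w ≡ᵇ 0) ∧ (#132 w ≡ᵇ 0) ∧ (i ≡ᵇ 0) ∧ (#123 w ≡ᵇ 3)))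
              (sym (inversions≥-bounded w<n))) ⟩
  wordSum n n (𝟙 ∘ admissible n 0 3)
    ≡⟨ wordSum-admissible n 0 3 z≤n ⟩
  avoiders n 0 3 ∎
  where open ≡-Reasoning

-- The linear recurrence

-- F (n + 4) − 8 F (n + 3) + 24 F (n + 2) − 32 F (n + 1) + 16 F n = 0, the recurrence with
-- characteristic polynomial (x − 2)⁴, with the negative terms moved across.
RecurrenceAt : (ℕ → ℕ) → ℕ → Set
RecurrenceAt F n = F (4 + n) + 24 * F (2 + n) + 16 * F n ≡ 8 * F (3 + n) + 32 * F (1 + n)

RecurrenceAt-+ : ∀ {F G n} → RecurrenceAt F n → RecurrenceAt G n → RecurrenceAt (λ k → F k + G k) n
RecurrenceAt-+ {F} {G} {n} recF recG = begin
  (F (4 + n) + G (4 + n)) + 24 * (F (2 + n) + G (2 + n)) + 16 * (F n + G n)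
    ≡⟨ regroupˡ (F (4 + n)) (G (4 + n)) (F (2 + n)) (G (2 + n)) (F n) (G n) ⟩
  (F (4 + n) + 24 * F (2 + n) + 16 * F n) + (G (4 + n) + 24 * G (2 + n) + 16 * G n)
    ≡⟨ cong₂ _+_ recF recG ⟩
  (8 * F (3 + n) + 32 * F (1 + n)) + (8 * G (3 + n) + 32 * G (1 + n))
    ≡⟨ regroupʳ (F (3 + n)) (G (3 + n)) (F (1 + n)) (G (1 + n)) ⟩
  8 * (F (3 + n) + G (3 + n)) + 32 * (F (1 + n) + G (1 + n)) ∎
  where
  open ≡-Reasoning
  regroupˡ : ∀ a b c d e f → (a + b) + 24 * (c + d) + 16 * (e + f)
                             ≡ (a + 24 * c + 16 * e) + (b + 24 * d + 16 * f)
  regroupˡ = solve-∀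
  regroupʳ : ∀ a b c d → (8 * a + 32 * c) + (8 * b + 32 * d) ≡ 8 * (a + b) + 32 * (c + d)
  regroupʳ = solve-∀

RecurrenceAt-if : ∀ b {F n} → RecurrenceAt F n → RecurrenceAt (λ k → if b then F k else 0) n
RecurrenceAt-if true  rec = rec
RecurrenceAt-if false rec = refl

RecurrenceAt-∑ : ∀ k (F : Fin k → ℕ → ℕ) {n} → (∀ i → RecurrenceAt (F i) n) →
                 RecurrenceAt (λ m → ∑[ i < k ] F i m) n
RecurrenceAt-∑ zero    F     recF = refl
RecurrenceAt-∑ (suc k) F {n} recF =
  RecurrenceAt-+ {F 0F} {λ m → ∑[ i < k ] F (1+ i) m} {n}
    (recF 0F) (RecurrenceAt-∑ k (F ∘ 1+) (recF ∘ 1+))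

RecurrenceAt-suc : ∀ {F G n} → (∀ k → n ≤ k → F k ≡ G (suc k)) →
                   RecurrenceAt F n → RecurrenceAt G (suc n)
RecurrenceAt-suc {F} {G} {n} F≡G recF = begin
  G (5 + n) + 24 * G (3 + n) + 16 * G (1 + n)
    ≡⟨ sym (cong₂ _+_ (cong₂ _+_ (at 4) (cong (24 *_) (at 2))) (cong (16 *_) (at 0))) ⟩
  F (4 + n) + 24 * F (2 + n) + 16 * F n
    ≡⟨ recF ⟩
  8 * F (3 + n) + 32 * F (1 + n)
    ≡⟨ cong₂ _+_ (cong (8 *_) (at 3)) (cong (32 *_) (at 1)) ⟩
  8 * G (4 + n) + 32 * G (2 + n) ∎
  where
  open ≡-Reasoning
  at : ∀ i → F (i + n) ≡ G (suc (i + n))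
  at i = F≡G (i + n) (m≤n+m n i)

6≤[4+h]C2 : ∀ h → 6 ≤ (4 + h) C 2
6≤[4+h]C2 zero    = ≤-refl
6≤[4+h]C2 (suc h) = ≤-trans (6≤[4+h]C2 h)
  (≤-trans (m≤n+m _ ((4 + h) C 1)) (≤-reflexive (nCk+nC[k+1]≡[n+1]C[k+1] (4 + h) 1)))

avoiders-unroll : ∀ {m} → 3 ≤ m → ∀ g r → r ≤ 3 →
                  avoiders (suc m) g r ≡ ∑[ h < 4 ] avoidersByFirst m g r (toℕ h)
avoiders-unroll {suc (suc (suc k))} (s≤s (s≤s (s≤s z≤n))) g r r≤3 =
  cong (λ t → byFirst 0 + (byFirst 1 + (byFirst 2 + (byFirst 3 + t))))
       (sum-zero k λ h → tooManyLarger (toℕ h))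
  where
  byFirst = avoidersByFirst (3 + k) g r
  tooManyLarger : ∀ h → byFirst (4 + h) ≡ 0
  tooManyLarger h
    rewrite ≤ᵇ-false {(4 + h) C 2} {r} (≤-trans (s≤s r≤3) (≤-trans (m≤m+n 4 2) (6≤[4+h]C2 h)))
          | ∧-zeroʳ (g ≤ᵇ suc (4 + h)) = refl

avoiders-recurrence-base : ∀ g r → g ≤ 3 → r ≤ 3 → RecurrenceAt (λ k → avoiders k g r) 5
avoiders-recurrence-base 0 0 _ _ = refl
avoiders-recurrence-base 0 1 _ _ = refl
avoiders-recurrence-base 0 2 _ _ = refl
avoiders-recurrence-base 0 3 _ _ = refl
avoiders-recurrence-base 1 0 _ _ = refl
avoiders-recurrence-base 1 1 _ _ = refl
avoiders-recurrence-base 1 2 _ _ = refl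
avoiders-recurrence-base 1 3 _ _ = refl
avoiders-recurrence-base 2 0 _ _ = refl
avoiders-recurrence-base 2 1 _ _ = refl
avoiders-recurrence-base 2 2 _ _ = refl
avoiders-recurrence-base 2 3 _ _ = refl
avoiders-recurrence-base 3 0 _ _ = refl
avoiders-recurrence-base 3 1 _ _ = refl
avoiders-recurrence-base 3 2 _ _ = refl
avoiders-recurrence-base 3 3 _ _ = refl
avoiders-recurrence-base (suc (suc (suc (suc _)))) _ (s≤s (s≤s (s≤s ()))) _
avoiders-recurrence-base _ (suc (suc (suc (suc _)))) _ (s≤s (s≤s (s≤s ())))

-- The implicit arguments n are given explicitly: inferring them makes Agda unfold avoiders.
avoiders-recurrence : ∀ {n} → 5 ≤′ n → ∀ g r → g ≤ 3 → r ≤ 3 →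
                      RecurrenceAt (λ k → avoiders k g r) n
avoiders-recurrence ≤′-refl                g r g≤3 r≤3 = avoiders-recurrence-base g r g≤3 r≤3
avoiders-recurrence {suc n} (≤′-step 5≤′n) g r g≤3 r≤3 =
  RecurrenceAt-suc {λ k → ∑[ h < 4 ] byFirst (toℕ h) k} {λ k → avoiders k g r} {n}
    (λ k n≤k → sym (avoiders-unroll (≤-trans 3≤n n≤k) g r r≤3))
    (RecurrenceAt-∑ 4 (λ h → byFirst (toℕ h)) {n} λ h → rec (toℕ h) (≤-pred (toℕ<n h)))
  where
  3≤n : 3 ≤ n
  3≤n = ≤-trans (m≤m+n 3 2) (≤′⇒≤ 5≤′n)
  byFirst : ℕ → ℕ → ℕ
  byFirst h k = avoidersByFirst k g r h
  rec : ∀ h → h ≤ 3 → RecurrenceAt (byFirst h) n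
  rec h h≤3 =
    RecurrenceAt-if ((g ≤ᵇ suc h) ∧ (h C 2 ≤ᵇ r)) {λ k → avoiders k h (r ∸ h C 2)} {n}
      (avoiders-recurrence {n} 5≤′n h (r ∸ h C 2) h≤3 (≤-trans (m∸n≤m r (h C 2)) r≤3))

module PowerSeries where

  open import Data.Integer using (ℤ; +_; -[1+_]; -_; _-_) renaming (_+_ to _+ℤ_; _*_ to _*ℤ_)
  import Data.Integer.Properties as ℤ
  import Data.Integer.Tactic.RingSolver as ℤ-Solver
  open import Algebra.Properties.Monoid.Sum ℤ.+-0-monoid using ()
    renaming (sum to sumℤ; sum-cong-≗ to sumℤ-cong-≗; sum-init-last to sumℤ-init-last;
              sum-replicate-zero to sumℤ-replicate-zero)

  sumZ-applyUpTo : ∀ n (g : ℕ → ℕ) (F : ℕ → ℤ) →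
                   sumZ (applyUpTo g n) F ≡ sumℤ {n} (λ i → F (g (toℕ i)))
  sumZ-applyUpTo zero    g F = refl
  sumZ-applyUpTo (suc n) g F = cong (F (g 0) +ℤ_) (sumZ-applyUpTo n (g ∘ suc) F)

  ⋆-as-sum : ∀ f g n → (f ⋆ g) n ≡ sumℤ {suc n} (λ k → f (toℕ k) *ℤ g (n ∸ toℕ k))
  ⋆-as-sum f g n = sumZ-applyUpTo (suc n) id (λ k → f k *ℤ g (n ∸ k))

  sumℤ-zero : ∀ n {F : Fin n → ℤ} → (∀ i → F i ≡ + 0) → sumℤ F ≡ + 0
  sumℤ-zero n F≡0 = trans (sumℤ-cong-≗ F≡0) (sumℤ-replicate-zero n)

  ⋆-cong : ∀ {f f′ g g′} n → (∀ k → f k ≡ f′ k) → (∀ k → g k ≡ g′ k) →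
           (f ⋆ g) n ≡ (f′ ⋆ g′) n
  ⋆-cong {f} {f′} {g} {g′} n f≗f′ g≗g′ =
    trans (⋆-as-sum f g n)
      (trans (sumℤ-cong-≗ {suc n} λ k → cong₂ _*ℤ_ (f≗f′ (toℕ k)) (g≗g′ (n ∸ toℕ k)))
        (sym (⋆-as-sum f′ g′ n)))

  ⋆-poly-[] : ∀ f n → (f ⋆ poly []) n ≡ + 0
  ⋆-poly-[] f n = trans (⋆-as-sum f (poly []) n) (sumℤ-zero (suc n) λ k → ℤ.*-zeroʳ (f (toℕ k)))

  ⋆-poly-∷ : ∀ f c cs n → (f ⋆ poly (c ∷ cs)) (suc n) ≡ (f ⋆ poly cs) n +ℤ f (suc n) *ℤ c
  ⋆-poly-∷ f c cs n = begin
    (f ⋆ poly (c ∷ cs)) (suc n)              ≡⟨ ⋆-as-sum f (poly (c ∷ cs)) (suc n) ⟩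
    sumℤ t                                   ≡⟨ sumℤ-init-last t ⟩
    sumℤ (t ∘ Fin.inject₁) +ℤ t (Fin.fromℕ (suc n))
      ≡⟨ cong₂ _+ℤ_ (trans (sumℤ-cong-≗ {suc n} shifted) (sym (⋆-as-sum f (poly cs) n))) last ⟩
    (f ⋆ poly cs) n +ℤ f (suc n) *ℤ c       ∎
    where
    open ≡-Reasoning
    t : Fin (suc (suc n)) → ℤ
    t k = f (toℕ k) *ℤ poly (c ∷ cs) (suc n ∸ toℕ k)
    shifted : ∀ k → t (Fin.inject₁ k) ≡ f (toℕ k) *ℤ poly cs (n ∸ toℕ k)
    shifted k rewrite toℕ-inject₁ k | +-∸-assoc 1 (≤-pred (toℕ<n k)) = refl
    last : t (Fin.fromℕ (suc n)) ≡ f (suc n) *ℤ c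
    last rewrite toℕ-fromℕ n | n∸n≡0 n = refl

  ⋆-poly-[c] : ∀ f c n → (f ⋆ poly (c ∷ [])) n ≡ f n *ℤ c
  ⋆-poly-[c] f c zero    = ℤ.+-identityʳ (f 0 *ℤ c)
  ⋆-poly-[c] f c (suc n) =
    trans (⋆-poly-∷ f c [] n) (trans (cong (_+ℤ f (suc n) *ℤ c) (⋆-poly-[] f n)) (ℤ.+-identityˡ _))

  ⋆-quartic : ∀ f c₀ c₁ c₂ c₃ c₄ m →
    (f ⋆ poly (c₀ ∷ c₁ ∷ c₂ ∷ c₃ ∷ c₄ ∷ [])) (4 + m)
    ≡ f m *ℤ c₄ +ℤ f (1 + m) *ℤ c₃ +ℤ f (2 + m) *ℤ c₂ +ℤ f (3 + m) *ℤ c₁ +ℤ f (4 + m) *ℤ c₀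
  ⋆-quartic f c₀ c₁ c₂ c₃ c₄ m
    rewrite ⋆-poly-∷ f c₀ (c₁ ∷ c₂ ∷ c₃ ∷ c₄ ∷ []) (3 + m)
          | ⋆-poly-∷ f c₁ (c₂ ∷ c₃ ∷ c₄ ∷ []) (2 + m)
          | ⋆-poly-∷ f c₂ (c₃ ∷ c₄ ∷ []) (1 + m)
          | ⋆-poly-∷ f c₃ (c₄ ∷ []) m
          | ⋆-poly-[c] f c₄ m = refl

  DegreeAtMost : ℕ → Series → Set
  DegreeAtMost d f = ∀ k → d < k → f k ≡ + 0

  ⋆-degree : ∀ {a b f g} → DegreeAtMost a f → DegreeAtMost b g → DegreeAtMost (a + b) (f ⋆ g)
  ⋆-degree {a} {b} {f} {g} deg-f deg-g n a+b<n = trans (⋆-as-sum f g n) (sumℤ-zero (suc n) term≡0)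
    where
    term≡0 : ∀ k → f (toℕ k) *ℤ g (n ∸ toℕ k) ≡ + 0
    term≡0 k with a <? toℕ k
    ... | yes a<k rewrite deg-f (toℕ k) a<k = refl
    ... | no  a≮k =
      trans (cong (f (toℕ k) *ℤ_) (deg-g (n ∸ toℕ k) b<n∸k)) (ℤ.*-zeroʳ (f (toℕ k)))
      where
      b<n∸k : b < n ∸ toℕ k
      b<n∸k = begin-strict
        b                  <⟨ n<1+n b ⟩
        suc b              ≡⟨ sym (m+n∸m≡n a (suc b)) ⟩
        a + suc b ∸ a      ≤⟨ ∸-monoˡ-≤ a (≤-trans (≤-reflexive (+-suc a b)) a+b<n) ⟩
        n ∸ a              ≤⟨ ∸-monoʳ-≤ n (≮⇒≥ a≮k) ⟩
        n ∸ toℕ k          ∎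
        where open ≤-Reasoning

  ^ₛ-degree : ∀ {d f} → DegreeAtMost d f → ∀ k → DegreeAtMost (k * d) (f ^ₛ k)
  ^ₛ-degree deg-f zero    (suc n) _ = refl
  ^ₛ-degree deg-f (suc k)           = ⋆-degree deg-f (^ₛ-degree deg-f k)

  linear-degree : ∀ c₀ c₁ → DegreeAtMost 1 (poly (c₀ ∷ c₁ ∷ []))
  linear-degree c₀ c₁ (suc (suc n)) _ = refl
  linear-degree c₀ c₁ (suc zero) (s≤s ())

  [1-2z]⁴ : List ℤ
  [1-2z]⁴ = + 1 ∷ -[1+ 7 ] ∷ + 24 ∷ -[1+ 31 ] ∷ + 16 ∷ []

  oneMinus2z^4≗[1-2z]⁴ : ∀ n → (oneMinus2z ^ₛ 4) n ≡ poly [1-2z]⁴ n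
  oneMinus2z^4≗[1-2z]⁴ 0 = refl
  oneMinus2z^4≗[1-2z]⁴ 1 = refl
  oneMinus2z^4≗[1-2z]⁴ 2 = refl
  oneMinus2z^4≗[1-2z]⁴ 3 = refl
  oneMinus2z^4≗[1-2z]⁴ 4 = refl
  oneMinus2z^4≗[1-2z]⁴ n@(suc (suc (suc (suc (suc _))))) =
    ^ₛ-degree (linear-degree (+ 1) -[1+ 1 ]) 4 n (s≤s (s≤s (s≤s (s≤s (s≤s z≤n)))))

  RecurrenceAt⇒⋆[1-2z]⁴≡0 : ∀ F m → RecurrenceAt F m → (ogf F ⋆ poly [1-2z]⁴) (4 + m) ≡ + 0
  RecurrenceAt⇒⋆[1-2z]⁴≡0 F m rec = begin
    (ogf F ⋆ poly [1-2z]⁴) (4 + m)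
      ≡⟨ ⋆-quartic (ogf F) (+ 1) -[1+ 7 ] (+ 24) -[1+ 31 ] (+ 16) m ⟩
    + F m *ℤ + 16 +ℤ + F (1 + m) *ℤ -[1+ 31 ] +ℤ + F (2 + m) *ℤ + 24
      +ℤ + F (3 + m) *ℤ -[1+ 7 ] +ℤ + F (4 + m) *ℤ + 1
      ≡⟨ separate (+ F m) (+ F (1 + m)) (+ F (2 + m)) (+ F (3 + m)) (+ F (4 + m)) ⟩
    (+ F (4 + m) +ℤ + 24 *ℤ + F (2 + m) +ℤ + 16 *ℤ + F m) - (+ 8 *ℤ + F (3 + m) +ℤ + 32 *ℤ + F (1 + m))
      ≡⟨ cong₂ _-_ (sym lhs) (sym rhs) ⟩
    + (F (4 + m) + 24 * F (2 + m) + 16 * F m) - + (8 * F (3 + m) + 32 * F (1 + m))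
      ≡⟨ cong (λ y → + (F (4 + m) + 24 * F (2 + m) + 16 * F m) - + y) (sym rec) ⟩
    + (F (4 + m) + 24 * F (2 + m) + 16 * F m) - + (F (4 + m) + 24 * F (2 + m) + 16 * F m)
      ≡⟨ ℤ.+-inverseʳ (+ (F (4 + m) + 24 * F (2 + m) + 16 * F m)) ⟩
    + 0 ∎
    where
    open ≡-Reasoning
    separate : ∀ x₀ x₁ x₂ x₃ x₄ →
      x₀ *ℤ + 16 +ℤ x₁ *ℤ - + 32 +ℤ x₂ *ℤ + 24 +ℤ x₃ *ℤ - + 8 +ℤ x₄ *ℤ + 1
      ≡ (x₄ +ℤ + 24 *ℤ x₂ +ℤ + 16 *ℤ x₀) - (+ 8 *ℤ x₃ +ℤ + 32 *ℤ x₁)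
    separate = ℤ-Solver.solve-∀
    lhs : + (F (4 + m) + 24 * F (2 + m) + 16 * F m)
          ≡ + F (4 + m) +ℤ + 24 *ℤ + F (2 + m) +ℤ + 16 *ℤ + F m
    lhs = trans (ℤ.pos-+ (F (4 + m) + 24 * F (2 + m)) (16 * F m))
            (cong₂ _+ℤ_ (trans (ℤ.pos-+ (F (4 + m)) (24 * F (2 + m)))
                               (cong (+ F (4 + m) +ℤ_) (ℤ.pos-* 24 (F (2 + m)))))
                        (ℤ.pos-* 16 (F m)))
    rhs : + (8 * F (3 + m) + 32 * F (1 + m)) ≡ + 8 *ℤ + F (3 + m) +ℤ + 32 *ℤ + F (1 + m)
    rhs = trans (ℤ.pos-+ (8 * F (3 + m)) (32 * F (1 + m)))
            (cong₂ _+ℤ_ (ℤ.pos-* 8 (F (3 + m))) (ℤ.pos-* 32 (F (1 + m))))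

  z⁵[z-1]²-degree : DegreeAtMost 7 ((z ^ₛ 5) ⋆ (zMinus1 ^ₛ 2))
  z⁵[z-1]²-degree =
    ⋆-degree (^ₛ-degree (linear-degree (+ 0) (+ 1)) 5) (^ₛ-degree (linear-degree -[1+ 0 ] (+ 1)) 2)

  ogf-cong : ∀ {F G} → (∀ k → F k ≡ G k) → ∀ k → ogf F k ≡ ogf G k
  ogf-cong F≗G k = cong +_ (F≗G k)

open PowerSeries

mainTheorem4 : (n : ℕ) →
    (ogf a ⋆ (oneMinus2z ^ₛ 4)) n ≡ ((z ^ₛ 5) ⋆ (zMinus1 ^ₛ 2)) n
mainTheorem4 n = begin
  (ogf a ⋆ (oneMinus2z ^ₛ 4)) n   ≡⟨ ⋆-cong n (ogf-cong a≡avoiders) oneMinus2z^4≗[1-2z]⁴ ⟩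
  (ogf a′ ⋆ poly [1-2z]⁴) n         ≡⟨ agree n ⟩
  ((z ^ₛ 5) ⋆ (zMinus1 ^ₛ 2)) n   ∎
  where
  open ≡-Reasoning
  a′ : ℕ → ℕ
  a′ k = avoiders k 0 3
  agree : ∀ n → (ogf a′ ⋆ poly [1-2z]⁴) n ≡ ((z ^ₛ 5) ⋆ (zMinus1 ^ₛ 2)) n
  agree 0 = refl
  agree 1 = refl
  agree 2 = refl
  agree 3 = refl
  agree 4 = refl
  agree 5 = refl
  agree 6 = refl
  agree 7 = refl
  agree 8 = refl
  agree n@(suc (suc (suc (suc m@(suc (suc (suc (suc (suc _))))))))) = trans
    (RecurrenceAt⇒⋆[1-2z]⁴≡0 a′ m
      (avoiders-recurrence {m} (≤⇒≤′ (s≤s (s≤s (s≤s (s≤s (s≤s z≤n)))))) 0 3 z≤n ≤-refl))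
    (sym (z⁵[z-1]²-degree n (s≤s (s≤s (s≤s (s≤s (s≤s (s≤s (s≤s (s≤s z≤n))))))))))
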